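{- Let $n>0$ and $k\geq 2$ be integers. Suppose $a,b,c,d$ are positive integers with $n^3\le a<b<c<d$, and suppose that $ac-n$, $bc-n$, $ad-n$, $bd-n$ are all perfect $k$-th powers. Then $$bd \geq k^k\, 2^{ -k}\, n^{ -k}\, (ac)^{k-1}.$$ -}

module Defs where

open import Data.Nat using (ℕ; _^_)
open import Data.Product using (∃)
open import Relation.Binary.PropositionalEquality using (_≡_)

IsPerfectPower : ℕ → ℕ → Set
IsPerfectPower k x = ∃ λ m → x ≡ m ^ k

{-# OPTIONS --safe #-}
-- Write P = ac, Q = bd and x^k = ac − n, y^k = bc − n, z^k = ad − n, w^k = bd − n.
-- Expanding shows (xw)^k + n(b − a)(d − c) = (yz)^k, so xw < yz and hence
-- k (xw)^(k−1) ≤ (xw + 1)^k − (xw)^k ≤ n(b − a)(d − c) ≤ nQ. Since n is small compared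
-- with P and Q, PQ ≤ 2 (xw)^k; raising this to the power k − 1 and combining it with the
-- previous bound eliminates xw and gives k^k P^(k−1) ≤ 2^(k−1) n^k Q.
module Submission where

open import Defs
open import Data.Nat using (ℕ; zero; suc; _+_; _*_; _∸_; _^_; _≤_; _<_; s≤s; NonZero; >-nonZero)
open import Data.Nat.Properties
open import Data.Nat.Tactic.RingSolver using (solve-∀)
open import Data.Product using (_,_)
open import Relation.Binary.PropositionalEquality

^-distrib-* : ∀ x y k → (x * y) ^ k ≡ x ^ k * y ^ k
^-distrib-* x y zero    = refl
^-distrib-* x y (suc k) = begin
  x * y * (x * y) ^ k      ≡⟨ cong (x * y *_) (^-distrib-* x y k) ⟩
  x * y * (x ^ k * y ^ k)  ≡⟨ interchange x y (x ^ k) (y ^ k) ⟩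
  x * x ^ k * (y * y ^ k)  ∎
  where
  open ≡-Reasoning
  interchange : ∀ x y X Y → x * y * (X * Y) ≡ x * X * (y * Y)
  interchange = solve-∀

∸≡⇒+≡ : ∀ {m n p} → n ≤ m → m ∸ n ≡ p → p + n ≡ m
∸≡⇒+≡ n≤m refl = m∸n+n≡m n≤m

binomial-lowerBound : ∀ u j → u ^ suc j + suc j * u ^ j ≤ suc u ^ suc j
binomial-lowerBound u zero    = ≤-reflexive (base u)
  where
  base : ∀ u → u * 1 + 1 * 1 ≡ (1 + u) * 1
  base = solve-∀
binomial-lowerBound u (suc j) = begin
  u ^ suc (suc j) + suc (suc j) * u ^ suc j                 ≤⟨ m≤m+n _ (suc j * u ^ j) ⟩
  u ^ suc (suc j) + suc (suc j) * u ^ suc j + suc j * u ^ j ≡⟨ expand u (u ^ j) j ⟩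
  suc u * (u ^ suc j + suc j * u ^ j)                        ≤⟨ *-monoʳ-≤ (suc u) (binomial-lowerBound u j) ⟩
  suc u ^ suc (suc j)                                        ∎
  where
  open ≤-Reasoning
  expand : ∀ u t j → u * (u * t) + suc (suc j) * (u * t) + suc j * t ≡ (1 + u) * (u * t + suc j * t)
  expand = solve-∀

^-gap-lowerBound : ∀ u v j t → 0 < t → u ^ suc j + t ≡ v ^ suc j → suc j * u ^ j ≤ t
^-gap-lowerBound u v j t 0<t gap = +-cancelˡ-≤ (u ^ suc j) _ _ (begin
  u ^ suc j + suc j * u ^ j  ≤⟨ binomial-lowerBound u j ⟩
  suc u ^ suc j              ≤⟨ ^-monoˡ-≤ (suc j) u<v ⟩
  v ^ suc j                  ≡⟨ gap ⟨
  u ^ suc j + t              ∎)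
  where
  open ≤-Reasoning
  u^k<v^k : u ^ suc j < v ^ suc j
  u^k<v^k = subst (u ^ suc j <_) gap (m<m+n (u ^ suc j) 0<t)
  u<v : u < v
  u<v = ≰⇒> (λ v≤u → <⇒≱ u^k<v^k (^-monoˡ-≤ (suc j) v≤u))

-- (ac − n)(bd − n) + n(b − a)(d − c) = (bc − n)(ad − n), stated without subtraction.
shiftedProducts-identity : ∀ n a b c d e f p q r s → a + e ≡ b → c + f ≡ d
  → p + n ≡ a * c → q + n ≡ b * c → r + n ≡ a * d → s + n ≡ b * d
  → p * s + n * (e * f) ≡ q * r
shiftedProducts-identity n a _ c _ e f p q r s refl refl ac bc ad bd =
  +-cancelʳ-≡ _ _ _ (begin
    p * s + n * (e * f) + (n * (q + r) + n * n)  ≡⟨ regroup (p * s) n (e * f) (q + r) ⟩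
    p * s + n * (q + r + e * f) + n * n          ≡⟨ cong (λ t → p * s + n * t + n * n) sums ⟨
    p * s + n * (p + s) + n * n                  ≡⟨ factor p s n ⟩
    (p + n) * (s + n)                            ≡⟨ cong₂ _*_ ac bd ⟩
    a * c * ((a + e) * (c + f))                  ≡⟨ swap a c e f ⟩
    (a + e) * c * (a * (c + f))                  ≡⟨ cong₂ _*_ bc ad ⟨
    (q + n) * (r + n)                            ≡⟨ unfactor q r n ⟩
    q * r + (n * (q + r) + n * n)                ∎)
  where
  open ≡-Reasoning
  regroup : ∀ P n t u → P + n * t + (n * u + n * n) ≡ P + n * (u + t) + n * n
  regroup = solve-∀
  factor : ∀ p s n → p * s + n * (p + s) + n * n ≡ (p + n) * (s + n)
  factor = solve-∀
  swap : ∀ a c e f → a * c * ((a + e) * (c + f)) ≡ (a + e) * c * (a * (c + f))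
  swap = solve-∀
  unfactor : ∀ q r n → (q + n) * (r + n) ≡ q * r + (n * (q + r) + n * n)
  unfactor = solve-∀
  pair-up : ∀ p s n → p + n + (s + n) ≡ p + s + (n + n)
  pair-up = solve-∀
  regroup-sums : ∀ q r t n → q + n + (r + n) + t ≡ q + r + t + (n + n)
  regroup-sums = solve-∀
  expand : ∀ a c e f → a * c + (a + e) * (c + f) ≡ (a + e) * c + a * (c + f) + e * f
  expand = solve-∀
  sums : p + s ≡ q + r + e * f
  sums = +-cancelʳ-≡ _ _ _ (begin
    p + s + (n + n)                   ≡⟨ pair-up p s n ⟨
    p + n + (s + n)                   ≡⟨ cong₂ _+_ ac bd ⟩
    a * c + (a + e) * (c + f)         ≡⟨ expand a c e f ⟩
    (a + e) * c + a * (c + f) + e * f ≡⟨ cong₂ (λ u v → u + v + e * f) bc ad ⟨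
    q + n + (r + n) + e * f           ≡⟨ regroup-sums q r (e * f) n ⟩
    q + r + e * f + (n + n)           ∎)

shiftedProduct-≤ : ∀ n X W P Q → X + n ≡ P → W + n ≡ Q → 3 * n ≤ P → 4 * n ≤ Q
  → P * Q ≤ 2 * (X * W)
shiftedProduct-≤ n X W _ _ refl refl 3n≤P 4n≤Q = *-cancelˡ-≤ 6 (begin
  6 * ((X + n) * (W + n))            ≡⟨ scale X W n ⟩
  (2 * X + 2 * n) * (3 * W + 3 * n)  ≤⟨ *-mono-≤ (+-monoʳ-≤ (2 * X) 2n≤X) (+-monoʳ-≤ (3 * W) 3n≤W) ⟩
  (2 * X + X) * (3 * W + W)          ≡⟨ collect X W ⟩
  6 * (2 * (X * W))                  ∎)
  where
  open ≤-Reasoning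
  scale : ∀ X W n → 6 * ((X + n) * (W + n)) ≡ (2 * X + 2 * n) * (3 * W + 3 * n)
  scale = solve-∀
  collect : ∀ X W → (2 * X + X) * (3 * W + W) ≡ 6 * (2 * (X * W))
  collect = solve-∀
  three : ∀ n → 3 * n ≡ 2 * n + n
  three = solve-∀
  four : ∀ n → 4 * n ≡ 3 * n + n
  four = solve-∀
  2n≤X : 2 * n ≤ X
  2n≤X = +-cancelʳ-≤ n _ _ (subst (_≤ X + n) (three n) 3n≤P)
  3n≤W : 3 * n ≤ W
  3n≤W = +-cancelʳ-≤ n _ _ (subst (_≤ W + n) (four n) 4n≤Q)

eliminate-u : ∀ j u P Q N → 0 < Q → suc j * u ^ j ≤ N * Q → P * Q ≤ 2 * u ^ suc j
  → suc j ^ suc j * P ^ j ≤ 2 ^ j * N ^ suc j * Q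
eliminate-u j u P Q N 0<Q gap PQ≤2u^k = *-cancelʳ-≤ _ _ (Q ^ j) {{>-nonZero (m^n>0 Q j)}} (begin
  k ^ k * P ^ j * Q ^ j          ≡⟨ trans (*-assoc (k ^ k) _ _) (cong (k ^ k *_) (sym (^-distrib-* P Q j))) ⟩
  k ^ k * (P * Q) ^ j            ≤⟨ *-monoʳ-≤ (k ^ k) (^-monoˡ-≤ j PQ≤2u^k) ⟩
  k ^ k * (2 * u ^ k) ^ j        ≡⟨ cong (k ^ k *_) (^-distrib-* 2 (u ^ k) j) ⟩
  k ^ k * (2 ^ j * (u ^ k) ^ j)  ≡⟨ cong (λ t → k ^ k * (2 ^ j * t)) ^-swap ⟩
  k ^ k * (2 ^ j * (u ^ j) ^ k)  ≡⟨ trans (rotate (k ^ k) (2 ^ j) _) (cong (2 ^ j *_) (sym (^-distrib-* k (u ^ j) k))) ⟩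
  2 ^ j * (k * u ^ j) ^ k        ≤⟨ *-monoʳ-≤ (2 ^ j) (^-monoˡ-≤ k gap) ⟩
  2 ^ j * (N * Q) ^ k            ≡⟨ cong (2 ^ j *_) (^-distrib-* N Q k) ⟩
  2 ^ j * (N ^ k * (Q * Q ^ j))  ≡⟨ reassociate (2 ^ j) (N ^ k) Q (Q ^ j) ⟩
  2 ^ j * N ^ k * Q * Q ^ j      ∎)
  where
  open ≤-Reasoning
  k : ℕ
  k = suc j
  instance
    Q-nonZero : NonZero Q
    Q-nonZero = >-nonZero 0<Q
  ^-swap : (u ^ k) ^ j ≡ (u ^ j) ^ k
  ^-swap = trans (^-*-assoc u k j) (trans (cong (u ^_) (*-comm k j)) (sym (^-*-assoc u j k)))
  rotate : ∀ K T U → K * (T * U) ≡ T * (K * U)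
  rotate = solve-∀
  reassociate : ∀ T N Q R → T * (N * (Q * R)) ≡ T * N * Q * R
  reassociate = solve-∀

shiftedPowers-bound : ∀ n j a b c d x y z w → 0 < n → a < b → c < d → 3 * n ≤ a * c → 4 * n ≤ b * d
  → x ^ suc j + n ≡ a * c → y ^ suc j + n ≡ b * c → z ^ suc j + n ≡ a * d → w ^ suc j + n ≡ b * d
  → suc j ^ suc j * (a * c) ^ j ≤ 2 ^ j * n ^ suc j * (b * d)
shiftedPowers-bound n j a b c d x y z w 0<n a<b c<d 3n≤ac 4n≤bd xac ybc zad wbd =
  eliminate-u j (x * w) (a * c) (b * d) n 0<bd gap PQ≤2u^k
  where
  k e f : ℕ
  k = suc j
  e = b ∸ a
  f = d ∸ c
  0<bd : 0 < b * d
  0<bd = ≤-trans 0<n (≤-trans (m≤n*m n 4) 4n≤bd)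
  0<n[ef] : 0 < n * (e * f)
  0<n[ef] = *-mono-≤ 0<n (*-mono-≤ (m<n⇒0<n∸m a<b) (m<n⇒0<n∸m c<d))
  identity : (x * w) ^ k + n * (e * f) ≡ (y * z) ^ k
  identity = begin
    (x * w) ^ k + n * (e * f)    ≡⟨ cong (_+ n * (e * f)) (^-distrib-* x w k) ⟩
    x ^ k * w ^ k + n * (e * f)  ≡⟨ shiftedProducts-identity n a b c d e f _ _ _ _
                                      (m+[n∸m]≡n (<⇒≤ a<b)) (m+[n∸m]≡n (<⇒≤ c<d)) xac ybc zad wbd ⟩
    y ^ k * z ^ k                ≡⟨ ^-distrib-* y z k ⟨
    (y * z) ^ k                  ∎
    where open ≡-Reasoning
  gap : k * (x * w) ^ j ≤ n * (b * d)
  gap = ≤-trans (^-gap-lowerBound (x * w) (y * z) j _ 0<n[ef] identity)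
                (*-monoʳ-≤ n (*-mono-≤ (m∸n≤m b a) (m∸n≤m d c)))
  PQ≤2u^k : a * c * (b * d) ≤ 2 * (x * w) ^ k
  PQ≤2u^k = subst (λ t → a * c * (b * d) ≤ 2 * t) (sym (^-distrib-* x w k))
                  (shiftedProduct-≤ n _ _ _ _ xac wbd 3n≤ac 4n≤bd)

lemma2p8 : (n k a b c d : ℕ) → 0 < n → 2 ≤ k → 0 < a
    → n ^ 3 ≤ a → a < b → b < c → c < d
    → IsPerfectPower k (a * c ∸ n) → IsPerfectPower k (b * c ∸ n)
    → IsPerfectPower k (a * d ∸ n) → IsPerfectPower k (b * d ∸ n)
    → k ^ k * (a * c) ^ (k ∸ 1) ≤ 2 ^ k * n ^ k * (b * d)
lemma2p8 n (suc j) a b c d 0<n _ 0<a n³≤a a<b b<c c<d (x , ac) (y , bc) (z , ad) (w , bd) =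
  ≤-trans (shiftedPowers-bound n j a b c d x y z w 0<n a<b c<d 3n≤ac 4n≤bd
             (∸≡⇒+≡ (n≤m⇒n≤m*p n≤a 3≤c) ac) (∸≡⇒+≡ (n≤m⇒n≤m*p n≤b 3≤c) bc)
             (∸≡⇒+≡ (n≤m⇒n≤m*p n≤a 4≤d) ad) (∸≡⇒+≡ (n≤m⇒n≤m*p n≤b 4≤d) bd))
          (*-monoˡ-≤ (b * d) (*-monoˡ-≤ (n ^ suc j) (m≤n*m (2 ^ j) 2)))
  where
  n≤a : n ≤ a
  n≤a = ≤-trans (m≤m*n n (n ^ 2) {{m^n≢0 n 2 {{>-nonZero 0<n}}}}) n³≤a
  n≤b : n ≤ b
  n≤b = ≤-trans n≤a (<⇒≤ a<b)
  3≤c : 3 ≤ c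
  3≤c = ≤-trans (s≤s (≤-trans (s≤s 0<a) a<b)) b<c
  4≤d : 4 ≤ d
  4≤d = ≤-trans (s≤s 3≤c) c<d
  n≤m⇒n≤m*p : ∀ {m p q} → n ≤ m → suc q ≤ p → n ≤ m * p
  n≤m⇒n≤m*p {m} n≤m (s≤s _) = ≤-trans n≤m (m≤m*n m _)
  3n≤ac : 3 * n ≤ a * c
  3n≤ac = ≤-trans (≤-reflexive (*-comm 3 n)) (*-mono-≤ n≤a 3≤c)
  4n≤bd : 4 * n ≤ b * d
  4n≤bd = ≤-trans (≤-reflexive (*-comm 4 n)) (*-mono-≤ n≤b 4≤d)
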